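{- For tests $t, t' \in \mathcal{T}$, $t \otimes t' = t \sqcup t'$.
   Context: Commands form a complete distributive lattice under refinement with nondeterministic choice $\sqcap$, conjunction $\sqcup$, infeasible $\top$, abort $\bot$; sequential composition $;$ is associative with identity $\mathbf{nil}$. Tests $\mathcal{T}$ form a Boolean algebra with complement $\neg$, least element $\mathbf{nil}$, greatest element $\top$, and $t;t' = t\sqcup t'$. A synchronisation operator $\otimes$ is associative, commutative, has identity command $\mathrm{Id}$, distributes over non-empty nondeterministic choices, and satisfies (for atomic steps $a,b$, commands $c,d$, tests $t$): $(a;c)\otimes(b;d) = (a\otimes b);(c\otimes d)$; $\mathbf{nil}\otimes\mathbf{nil}=\mathbf{nil}$; $(a;c)\otimes\mathbf{nil}=\top$; $(t;c)\otimes(t;d)=t;(c\otimes d)$. It is known that for tests $t,t'$, $t'\otimes(t;d) = t;(t'\otimes d)$. -}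

module Defs where

open import Level using (Level) renaming (_⊔_ to _⊔ˡ_; suc to lsuc)
open import Relation.Binary.PropositionalEquality using (_≡_)
open import Algebra.Lattice.Structures using (IsDistributiveLattice; IsBooleanAlgebra)

-- The algebraic setting of the paper ("synchronous program algebra"),
-- packaged as a record of assumptions.
--   _⊓_ : nondeterministic choice (lattice meet w.r.t. refinement)
--   _⊔_ : conjunction (lattice join)
--   ⊤   : infeasible (greatest), ⊥ : abort (least)
--   _⨾_ : sequential composition, identity nil
--   Test : the tests, embedded into commands by ⌈_⌉
--   Atomic : predicate singling out atomic step commands
--   _⊗_ : the synchronisation operator with identity Id
record SyncAlgebra (c ℓ : Level) : Set (lsuc (c ⊔ˡ ℓ)) where
  infixr 7 _⨾_
  infixl 6 _⊓_ _⊔_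
  infixl 5 _⊗_
  field
    Cmd : Set c
    _⊓_ _⊔_ : Cmd → Cmd → Cmd
    ⊤ ⊥ : Cmd
    isDistributiveLattice : IsDistributiveLattice _≡_ _⊔_ _⊓_
    -- refinement order c ⊑ d  :=  c ⊓ d ≡ c
    ⊥-least : ∀ x → ⊥ ⊓ x ≡ ⊥
    ⊤-greatest : ∀ x → x ⊓ ⊤ ≡ x
    ⨅ : {I : Set ℓ} → (I → Cmd) → Cmd
    ⨅-lower : {I : Set ℓ} (f : I → Cmd) (i : I) → ⨅ f ⊓ f i ≡ ⨅ f
    ⨅-greatest : {I : Set ℓ} (f : I → Cmd) (x : Cmd) →
                 (∀ i → x ⊓ f i ≡ x) → x ⊓ ⨅ f ≡ x
    _⨾_ : Cmd → Cmd → Cmd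
    nil : Cmd
    ⨾-assoc : ∀ x y z → (x ⨾ y) ⨾ z ≡ x ⨾ (y ⨾ z)
    ⨾-identityˡ : ∀ x → nil ⨾ x ≡ x
    ⨾-identityʳ : ∀ x → x ⨾ nil ≡ x
    Test : Set c
    ⌈_⌉ : Test → Cmd
    ⌈⌉-injective : ∀ {t t'} → ⌈ t ⌉ ≡ ⌈ t' ⌉ → t ≡ t'
    _∨ₜ_ _∧ₜ_ : Test → Test → Test
    ¬ₜ : Test → Test
    nilₜ ⊤ₜ : Test
    isBooleanAlgebra : IsBooleanAlgebra _≡_ _∨ₜ_ _∧ₜ_ ¬ₜ ⊤ₜ nilₜ
    ⌈nilₜ⌉ : ⌈ nilₜ ⌉ ≡ nil
    ⌈⊤ₜ⌉ : ⌈ ⊤ₜ ⌉ ≡ ⊤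
    ⌈∨ₜ⌉ : ∀ t t' → ⌈ t ∨ₜ t' ⌉ ≡ ⌈ t ⌉ ⊔ ⌈ t' ⌉
    ⌈∧ₜ⌉ : ∀ t t' → ⌈ t ∧ₜ t' ⌉ ≡ ⌈ t ⌉ ⊓ ⌈ t' ⌉
    test-⨾ : ∀ t t' → ⌈ t ⌉ ⨾ ⌈ t' ⌉ ≡ ⌈ t ⌉ ⊔ ⌈ t' ⌉
    Atomic : Cmd → Set c
    _⊗_ : Cmd → Cmd → Cmd
    Id : Cmd
    ⊗-assoc : ∀ x y z → (x ⊗ y) ⊗ z ≡ x ⊗ (y ⊗ z)
    ⊗-comm : ∀ x y → x ⊗ y ≡ y ⊗ x
    ⊗-identityˡ : ∀ x → Id ⊗ x ≡ x
    ⊗-distrib-⨅ : {I : Set ℓ} (f : I → Cmd) (i : I) (x : Cmd) →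
                  x ⊗ ⨅ f ≡ ⨅ (λ j → x ⊗ f j)
    ⊗-distrib-⊓ : ∀ x y z → x ⊗ (y ⊓ z) ≡ (x ⊗ y) ⊓ (x ⊗ z)
    ⊗-atomic-⨾ : ∀ a b x y → Atomic a → Atomic b →
                 (a ⨾ x) ⊗ (b ⨾ y) ≡ (a ⊗ b) ⨾ (x ⊗ y)
    ⊗-nil : nil ⊗ nil ≡ nil
    ⊗-atomic-nil : ∀ a x → Atomic a → (a ⨾ x) ⊗ nil ≡ ⊤
    ⊗-test-⨾ : ∀ t x y → (⌈ t ⌉ ⨾ x) ⊗ (⌈ t ⌉ ⨾ y) ≡ ⌈ t ⌉ ⨾ (x ⊗ y)
    -- previously established fact (stated as known in the paper)
    ⊗-test-pull : ∀ t t' d → ⌈ t' ⌉ ⊗ (⌈ t ⌉ ⨾ d) ≡ ⌈ t ⌉ ⨾ (⌈ t' ⌉ ⊗ d)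

-- A test t is t ⨾ nil, so the known law t' ⊗ (t ⨾ d) = t ⨾ (t' ⊗ d) pulls t out of
-- t' ⊗ t, leaving t ⨾ (t' ⊗ nil).  Applying the same law with t' := nil (itself a
-- test) and nil ⊗ nil = nil shows that tests are units for ⊗ against nil, so what
-- remains is t ⨾ t', which for tests is t ⊔ t'.
module Submission where

open import Defs
open import Level using (Level)
open import Relation.Binary.PropositionalEquality using (_≡_; sym; trans; cong; module ≡-Reasoning)

module TestSynchronisation {c ℓ : Level} (A : SyncAlgebra c ℓ) where
  open SyncAlgebra A
  open ≡-Reasoning

  ⊗-test-pull-nil : ∀ t t' → ⌈ t' ⌉ ⊗ ⌈ t ⌉ ≡ ⌈ t ⌉ ⨾ (⌈ t' ⌉ ⊗ nil)
  ⊗-test-pull-nil t t' = begin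
    ⌈ t' ⌉ ⊗ ⌈ t ⌉          ≡⟨ cong (⌈ t' ⌉ ⊗_) (sym (⨾-identityʳ ⌈ t ⌉)) ⟩
    ⌈ t' ⌉ ⊗ (⌈ t ⌉ ⨾ nil)  ≡⟨ ⊗-test-pull t t' nil ⟩
    ⌈ t ⌉ ⨾ (⌈ t' ⌉ ⊗ nil)  ∎

  ⊗-nil-test : ∀ t → nil ⊗ ⌈ t ⌉ ≡ ⌈ t ⌉
  ⊗-nil-test t = begin
    nil ⊗ ⌈ t ⌉             ≡⟨ cong (_⊗ ⌈ t ⌉) (sym ⌈nilₜ⌉) ⟩
    ⌈ nilₜ ⌉ ⊗ ⌈ t ⌉        ≡⟨ ⊗-test-pull-nil t nilₜ ⟩
    ⌈ t ⌉ ⨾ (⌈ nilₜ ⌉ ⊗ nil) ≡⟨ cong (λ n → ⌈ t ⌉ ⨾ (n ⊗ nil)) ⌈nilₜ⌉ ⟩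
    ⌈ t ⌉ ⨾ (nil ⊗ nil)     ≡⟨ cong (⌈ t ⌉ ⨾_) ⊗-nil ⟩
    ⌈ t ⌉ ⨾ nil             ≡⟨ ⨾-identityʳ ⌈ t ⌉ ⟩
    ⌈ t ⌉                   ∎

  test-⊗-nil : ∀ t → ⌈ t ⌉ ⊗ nil ≡ ⌈ t ⌉
  test-⊗-nil t = trans (⊗-comm ⌈ t ⌉ nil) (⊗-nil-test t)

  test-⊗-test : ∀ t t' → ⌈ t ⌉ ⊗ ⌈ t' ⌉ ≡ ⌈ t ⌉ ⊔ ⌈ t' ⌉
  test-⊗-test t t' = begin
    ⌈ t ⌉ ⊗ ⌈ t' ⌉          ≡⟨ ⊗-comm ⌈ t ⌉ ⌈ t' ⌉ ⟩
    ⌈ t' ⌉ ⊗ ⌈ t ⌉          ≡⟨ ⊗-test-pull-nil t t' ⟩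
    ⌈ t ⌉ ⨾ (⌈ t' ⌉ ⊗ nil)  ≡⟨ cong (⌈ t ⌉ ⨾_) (test-⊗-nil t') ⟩
    ⌈ t ⌉ ⨾ ⌈ t' ⌉          ≡⟨ test-⨾ t t' ⟩
    ⌈ t ⌉ ⊔ ⌈ t' ⌉          ∎

mainTheorem5 : ∀ {c ℓ : Level} (A : SyncAlgebra c ℓ) (t t' : SyncAlgebra.Test A) →
    SyncAlgebra._⊗_ A (SyncAlgebra.⌈_⌉ A t) (SyncAlgebra.⌈_⌉ A t')
    ≡ SyncAlgebra._⊔_ A (SyncAlgebra.⌈_⌉ A t) (SyncAlgebra.⌈_⌉ A t')
mainTheorem5 A = TestSynchronisation.test-⊗-test A
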